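{- Let $d\ge 1$, let $g:\mathbb{N}\to\mathbb{N}$ be monotone and expansive, and let $n_0\in\mathbb{N}$. Let $D_0\supsetneq D_1\supsetneq\cdots$ be a $(g,n_0)$-controlled strongly monotone descending chain of downwards-closed subsets of $\mathbb{N}^d$. If $I_\ell$ is an order ideal that is proper at some step $\ell$, then $I_\ell$ is thin and $\ell\le L_{\operatorname{fdim} I_\ell}$.
   Context: $\mathbb{N}^d$ is ordered componentwise by $\sqsubseteq$. A set $D\subseteq\mathbb{N}^d$ is downwards-closed if $x\in D$ and $y\sqsubseteq x$ imply $y\in D$. Let $\mathbb{N}_\omega=\mathbb{N}\cup\{\omega\}$ with $\omega$ larger than every natural number. The order ideals of $\mathbb{N}^d$ (non-empty, directed, downwards-closed subsets) are exactly the sets $\{x\in\mathbb{N}^d : x\sqsubseteq v\}$ for $v\in\mathbb{N}_\omega^d$; an ideal $I$ is identified with this vector $v$, so $I(i)\in\mathbb{N}_\omega$. For an ideal $I$: $\omega(I)=\{i : I(i)=\omega\}$, $\mathrm{fin}(I)=\{1,\dots,d\}\setminus\omega(I)$, $\dim I=|\omega(I)|$, $\operatorname{fdim} I=d-\dim I$, and $\|I\|=\max_{i\in\mathrm{fin}(I)}I(i)$ (taken as $0$ if $\mathrm{fin}(I)=\emptyset$). Every downwards-closed $D$ is uniquely a finite union of pairwise inclusion-incomparable ideals (its canonical decomposition); write $I\in D$ when $I$ belongs to this decomposition, and $\|D\|=\max_{I\in D}\|I\|$. In a descending chain $D_0\supsetneq D_1\supsetneq\cdots$, an ideal $I$ is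 proper at step $k$ if $I\in D_k$ and $I\notin D_{k+1}$. The chain is strongly monotone if whenever $I$ is proper at step $k+1$ there is $I'$ proper at step $k$ with $\dim I\le\dim I'$. For $g$ monotone ($x\le y\Rightarrow g(x)\le g(y)$) and expansive ($x\le g(x)$) and $n_0\in\mathbb{N}$, the chain is $(g,n_0)$-controlled if $\|D_k\|\le g^k(n_0)$ for all $k$ ($g^k$ the $k$-th iterate). Define $N_0=n_0$, $L_0=0$ and for $0\le i<d$: $N_{i+1}=g^{L_i+1}(n_0)$ and $L_{i+1}=L_i+\prod_{1\le j\le i+1}(d-j+1)(N_j+1)$. An ideal $I$ of $\mathbb{N}^d$ is thin if there is a bijection $\sigma:\mathrm{fin}(I)\to\{1,\dots,\operatorname{fdim}I\}$ with $I(i)\le N_{\sigma(i)}$ for all $i\in\mathrm{fin}(I)$. -}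

module Defs where

open import Data.Nat using (ℕ; zero; suc; _+_; _*_; _∸_; _≤_; _<_; _⊔_)
open import Data.Bool using (Bool; true; false; T; if_then_else_)
open import Data.Fin using (Fin; toℕ)
open import Data.Vec using (Vec; lookup)
open import Data.List using (List; map; foldr; allFin)
open import Data.Nat.ListAction using (sum)
open import Data.List.Membership.Propositional using (_∈_)
open import Data.List.Relation.Unary.Any using (Any)
open import Data.List.Relation.Unary.AllPairs using (AllPairs)
open import Data.Product using (Σ; ∃; _×_)
open import Relation.Nullary using (¬_)
open import Function.Bundles using (_⤖_; Bijection)

data ℕω : Set where
  fin : ℕ → ℕω
  ω   : ℕω

data _≤ω_ : ℕω → ℕω → Set where
  fin≤fin : ∀ {m n} → m ≤ n → fin m ≤ω fin n
  _≤ω-ω   : ∀ x → x ≤ω ω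

isω : ℕω → Bool
isω (fin _) = false
isω ω       = true

isFin : ℕω → Bool
isFin (fin _) = true
isFin ω       = false

-- value of a finite entry (0 for ω; only used on finite entries)
finVal : ℕω → ℕ
finVal (fin n) = n
finVal ω       = 0

Point : ℕ → Set
Point d = Fin d → ℕ

-- An order ideal of ℕ^d, identified with its vector in ℕ_ω^d
Ideal : ℕ → Set
Ideal d = Vec ℕω d

_∈I_ : ∀ {d} → Point d → Ideal d → Set
x ∈I I = ∀ i → fin (x i) ≤ω lookup I i

_⊆I_ : ∀ {d} → Ideal d → Ideal d → Set
I ⊆I J = ∀ x → x ∈I I → x ∈I J

dim : ∀ {d} → Ideal d → ℕ
dim {d} I = sum (map (λ i → if isω (lookup I i) then 1 else 0) (allFin d))

fdim : ∀ {d} → Ideal d → ℕ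
fdim {d} I = d ∸ dim I

norm : ∀ {d} → Ideal d → ℕ
norm {d} I = foldr _⊔_ 0 (map (λ i → finVal (lookup I i)) (allFin d))

FinCoord : ∀ {d} → Ideal d → Set
FinCoord {d} I = Σ (Fin d) (λ i → T (isFin (lookup I i)))

-- A downwards-closed set given by a finite list of ideals;
-- the set it denotes is the union.
DC : ℕ → Set
DC d = List (Ideal d)

⟦_⟧ : ∀ {d} → DC d → Point d → Set
⟦ D ⟧ x = Any (λ I → x ∈I I) D

_⊆S_ : ∀ {d} → (Point d → Set) → (Point d → Set) → Set
A ⊆S B = ∀ x → A x → B x

Canonical : ∀ {d} → DC d → Set
Canonical D = AllPairs (λ I J → ¬ (I ⊆I J) × ¬ (J ⊆I I)) D

iter : (ℕ → ℕ) → ℕ → ℕ → ℕ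
iter g zero    x = x
iter g (suc k) x = g (iter g k x)

Monotone : (ℕ → ℕ) → Set
Monotone g = ∀ x y → x ≤ y → g x ≤ g y

Expansive : (ℕ → ℕ) → Set
Expansive g = ∀ x → x ≤ g x

module Bounds (d : ℕ) (g : ℕ → ℕ) (n₀ : ℕ) where
  mutual
    N : ℕ → ℕ
    N zero    = n₀
    N (suc i) = iter g (L i + 1) n₀

    L : ℕ → ℕ
    L zero    = 0
    L (suc i) = L i + P (suc i)

    P : ℕ → ℕ
    P zero    = 1
    P (suc i) = P i * ((d ∸ suc i + 1) * (N (suc i) + 1))

  Thin : Ideal d → Set
  Thin I = Σ (FinCoord I ⤖ Fin (fdim I)) λ σ →
             ∀ (c : FinCoord I) →
               finVal (lookup I (Data.Product.proj₁ c)) ≤ N (suc (toℕ (Bijection.to σ c)))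

module Chain {d : ℕ} (D : ℕ → DC d) where
  Proper : ℕ → Ideal d → Set
  Proper k I = I ∈ D k × ¬ (I ∈ D (suc k))

  IsDescendingChain : ℕ → Set
  IsDescendingChain n =
    (∀ k → k ≤ n → Canonical (D k)) ×
    (∀ k → k < n → (⟦ D (suc k) ⟧ ⊆S ⟦ D k ⟧) × ¬ (⟦ D k ⟧ ⊆S ⟦ D (suc k) ⟧))

  StronglyMonotone : ℕ → Set
  StronglyMonotone n = ∀ k → suc k < n → ∀ I → Proper (suc k) I →
    ∃ λ I′ → Proper k I′ × dim I ≤ dim I′

  Controlled : (ℕ → ℕ) → ℕ → ℕ → Set
  Controlled g n₀ n = ∀ k → k ≤ n → ∀ I → I ∈ D k → norm I ≤ iter g k n₀

module Submission where

-- Ideals are prime, so every ideal J of D (k + 1) lies below an ideal K of D k; by canonicity either J = K, or K is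
-- proper at step k and J only adds finite coordinates, all bounded by ‖D (k + 1)‖ ≤ g^(k+1)(n₀). Once we know that
-- k ≤ L (fdim K), this bound is at most N (fdim K + 1), which is exactly what thinness asks of the new coordinates;
-- so thinness of all ideals of D k and the time bound for ideals proper at k are proved by a joint induction on k.
-- For the time bound, strong monotonicity traces an ideal I proper at step ℓ back to ideals proper at every earlier
-- step whose finite dimension is at most fdim I. These are pairwise distinct, since a proper ideal never reappears.
-- As long as their finite dimension equals fdim I they are distinct thin ideals of that finite dimension, and there
-- are at most P (fdim I) of those; at the first step where the finite dimension drops, the induction hypothesis
-- bounds the remaining time by L (fdim I - 1), and L (fdim I) = L (fdim I - 1) + P (fdim I).

open import Defs
open import Data.Nat using (ℕ; zero; suc; _+_; _∸_; _≤_; _<_; _⊔_; pred; _≤′_; ≤′-refl; ≤′-step; z≤n; s≤s; s≤s⁻¹; z<s; _<?_)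
open import Data.Nat.Properties
open import Data.Nat.Induction using (<-rec)
open import Data.Nat.ListAction using (sum)
open import Data.Bool using (T; if_then_else_)
open import Data.Bool.Properties using (T-irrelevant)
open import Data.Fin using (Fin; toℕ; opposite; combine) renaming (_≟_ to _≟ᶠ_)
import Data.Fin.Properties as Finₚ
open import Data.Vec using (lookup; replicate)
open import Data.Vec.Properties using (tabulate∘lookup; tabulate-cong; lookup-replicate)
import Data.Vec.Properties as Vecₚ
open import Data.List using (List; []; _∷_; _++_; map; foldr; allFin; length; filter)
import Data.List as List
open import Data.List.Properties using (length-++; length-tabulate; filter-none)
open import Data.List.Membership.Propositional using (_∈_; _∉_; find; lose)
open import Data.List.Membership.Propositional.Properties using (∈-allFin; ∈-filter⁺; ∈-filter⁻; ∈-lookup)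
open import Data.List.Membership.Propositional.Properties.WithK using (unique⇒irrelevant)
import Data.List.Membership.DecPropositional as DecMembership
open import Data.List.Relation.Unary.Any as Any using (here; there)
open import Data.List.Relation.Unary.Any.Properties using (lookup-index; ++⁺ˡ; ++⁺ʳ; ++⁻)
import Data.List.Relation.Unary.All as All
open import Data.List.Relation.Unary.All.Properties using (All¬⇒¬Any)
open import Data.List.Relation.Unary.AllPairs using ([]; _∷_)
open import Data.List.Relation.Unary.Unique.Propositional using (Unique)
import Data.List.Relation.Unary.Unique.Propositional.Properties as Uniqueₚ
open import Data.Product using (Σ; ∃; _×_; _,_; proj₁; proj₂; uncurry)
open import Data.Sum using (_⊎_; inj₁; inj₂; [_,_]′)
open import Data.Unit using (⊤; tt)
open import Data.Empty using (⊥; ⊥-elim)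
open import Function using (_∘_)
open import Function.Bundles using (_⤖_; Bijection; mk↔ₛ′)
open import Function.Properties.Inverse using (↔⇒⤖)
open import Relation.Nullary using (¬_; yes; no)
open import Relation.Nullary.Decidable using (T?; _×-dec_)
open import Relation.Unary using (Decidable)
open import Relation.Binary.Definitions using (DecidableEquality)
open import Relation.Binary.PropositionalEquality

≤ω-trans : ∀ {x y z} → x ≤ω y → y ≤ω z → x ≤ω z
≤ω-trans (fin≤fin p) (fin≤fin q) = fin≤fin (≤-trans p q)
≤ω-trans _           (_ ≤ω-ω)    = _ ≤ω-ω

≤ω-antisym : ∀ {x y} → x ≤ω y → y ≤ω x → x ≡ y
≤ω-antisym (fin≤fin p) (fin≤fin q) = cong fin (≤-antisym p q)
≤ω-antisym (_ ≤ω-ω)    (_ ≤ω-ω)    = refl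

IsFinite : ℕω → Set
IsFinite a = T (isFin a)

finite⊎ω : ∀ a → IsFinite a ⊎ T (isω a)
finite⊎ω (fin _) = inj₁ tt
finite⊎ω ω       = inj₂ tt

finite∧ω⇒⊥ : ∀ a → IsFinite a → T (isω a) → ⊥
finite∧ω⇒⊥ (fin _) _ ()

finite⇒≡fin : ∀ {a} → IsFinite a → a ≡ fin (finVal a)
finite⇒≡fin {fin _} _ = refl

ω⇒≡ω : ∀ {a} → T (isω a) → a ≡ ω
ω⇒≡ω {ω} _ = refl

≤ω-finite : ∀ {a b} → a ≤ω b → IsFinite b → IsFinite a
≤ω-finite (fin≤fin _) _ = tt

≤ω-finVal : ∀ {a b} → a ≤ω b → IsFinite b → finVal a ≤ finVal b
≤ω-finVal (fin≤fin a≤b) _ = a≤b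

_≟ω_ : DecidableEquality ℕω
fin a ≟ω fin b with a Data.Nat.≟ b
... | yes refl = yes refl
... | no  a≢b  = no λ { refl → a≢b refl }
fin _ ≟ω ω     = no λ ()
ω     ≟ω fin _ = no λ ()
ω     ≟ω ω     = yes refl

max-bound : ∀ {A : Set} (f : A → ℕ) {xs : List A} {x} → x ∈ xs → f x ≤ foldr _⊔_ 0 (map f xs)
max-bound f {y ∷ _} (here refl) = m≤m⊔n (f y) _
max-bound f {y ∷ _} (there x∈xs) = ≤-trans (max-bound f x∈xs) (m≤n⊔m (f y) _)

stepwise-monotone : (f : ℕ → ℕ) → (∀ i → f i ≤ f (suc i)) → ∀ {a b} → a ≤ b → f a ≤ f b
stepwise-monotone f step a≤b = go (≤⇒≤′ a≤b)
  where
    go : ∀ {a b} → a ≤′ b → f a ≤ f b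
    go ≤′-refl       = ≤-refl
    go (≤′-step a≤b) = ≤-trans (go a≤b) (step _)

iter-mono : ∀ {g} → Expansive g → ∀ x {a b} → a ≤ b → iter g a x ≤ iter g b x
iter-mono {g} expansive x = stepwise-monotone (λ k → iter g k x) (λ k → expansive (iter g k x))

index-∈-lookup : ∀ {A : Set} (xs : List A) i → Any.index (∈-lookup {xs = xs} i) ≡ i
index-∈-lookup (_ ∷ _)  Fin.zero    = refl
index-∈-lookup (_ ∷ xs) (Fin.suc i) = cong Fin.suc (index-∈-lookup xs i)

module _ {A : Set} (_≟_ : DecidableEquality A) where

  remove : A → List A → List A
  remove c [] = []
  remove c (x ∷ xs) with x ≟ c
  ... | yes _ = xs
  ... | no  _ = x ∷ remove c xs

  position : A → List A → ℕ
  position c [] = 0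
  position c (x ∷ xs) with x ≟ c
  ... | yes _ = 0
  ... | no  _ = suc (position c xs)

  length-remove : ∀ {c} xs → c ∈ xs → suc (length (remove c xs)) ≡ length xs
  length-remove {c} (x ∷ xs) c∈ with x ≟ c
  length-remove (x ∷ xs) _           | yes _   = refl
  length-remove (x ∷ xs) (here refl) | no  x≢c = ⊥-elim (x≢c refl)
  length-remove (x ∷ xs) (there c∈)  | no  _   = cong suc (length-remove xs c∈)

  ∈-remove : ∀ {c y} xs → y ∈ xs → y ≢ c → y ∈ remove c xs
  ∈-remove {c} (x ∷ xs) y∈ y≢c with x ≟ c
  ∈-remove (x ∷ xs) (here refl) y≢c | yes refl = ⊥-elim (y≢c refl)
  ∈-remove (x ∷ xs) (there y∈)  _   | yes _    = y∈
  ∈-remove (x ∷ xs) (here refl) _   | no  _    = here refl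
  ∈-remove (x ∷ xs) (there y∈)  y≢c | no  _    = there (∈-remove xs y∈ y≢c)

  position< : ∀ {c} xs → c ∈ xs → position c xs < length xs
  position< {c} (x ∷ xs) c∈ with x ≟ c
  position< (x ∷ xs) _           | yes _   = s≤s z≤n
  position< (x ∷ xs) (here refl) | no  x≢c = ⊥-elim (x≢c refl)
  position< (x ∷ xs) (there c∈)  | no  _   = s≤s (position< xs c∈)

  position-injective : ∀ {c c′} xs → c ∈ xs → c′ ∈ xs → position c xs ≡ position c′ xs → c ≡ c′
  position-injective {c} {c′} (x ∷ xs) c∈ c′∈ eq with x ≟ c | x ≟ c′
  position-injective (x ∷ xs) _           _            _  | yes refl | yes refl = refl
  position-injective (x ∷ xs) _           _            () | yes _    | no  _
  position-injective (x ∷ xs) _           _            () | no  _    | yes _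
  position-injective (x ∷ xs) (here refl) _            _  | no  x≢c  | no  _    = ⊥-elim (x≢c refl)
  position-injective (x ∷ xs) (there _)   (here refl)  _  | no  _    | no  x≢c′ = ⊥-elim (x≢c′ refl)
  position-injective (x ∷ xs) (there c∈)  (there c′∈)  eq | no  _    | no  _    =
    position-injective xs c∈ c′∈ (suc-injective eq)

clamp : (n : ℕ) → ℕ → Fin (n + 1)
clamp zero    _       = Fin.zero
clamp (suc n) zero    = Fin.zero
clamp (suc n) (suc k) = Fin.suc (clamp n k)

toℕ-clamp : ∀ {n k} → k ≤ n → toℕ (clamp n k) ≡ k
toℕ-clamp {zero}  z≤n     = refl
toℕ-clamp {suc n} z≤n     = refl
toℕ-clamp {suc n} (s≤s p) = cong suc (toℕ-clamp p)

clamp-injective : ∀ {n a b} → a ≤ n → b ≤ n → clamp n a ≡ clamp n b → a ≡ b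
clamp-injective a≤n b≤n eq = trans (sym (toℕ-clamp a≤n)) (trans (cong toℕ eq) (toℕ-clamp b≤n))

module _ {d : ℕ} where

  infix 4 _≤ᵢ_

  record _≤ᵢ_ (J K : Ideal d) : Set where
    constructor pointwise
    field at : ∀ i → lookup J i ≤ω lookup K i

  open _≤ᵢ_ public

  ≤ᵢ-trans : ∀ {I J K : Ideal d} → I ≤ᵢ J → J ≤ᵢ K → I ≤ᵢ K
  ≤ᵢ-trans p q = pointwise λ i → ≤ω-trans (at p i) (at q i)

  Ideal-ext : ∀ {J K : Ideal d} → (∀ i → lookup J i ≡ lookup K i) → J ≡ K
  Ideal-ext {J} {K} h = trans (sym (tabulate∘lookup J)) (trans (tabulate-cong h) (tabulate∘lookup K))

  ≤ᵢ-antisym : ∀ {J K : Ideal d} → J ≤ᵢ K → K ≤ᵢ J → J ≡ K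
  ≤ᵢ-antisym p q = Ideal-ext λ i → ≤ω-antisym (at p i) (at q i)

  ≤ᵢ⇒⊆I : ∀ {J K : Ideal d} → J ≤ᵢ K → J ⊆I K
  ≤ᵢ⇒⊆I J≤K x x∈J i = ≤ω-trans (x∈J i) (at J≤K i)

  lookup≤norm : ∀ (K : Ideal d) i → finVal (lookup K i) ≤ norm K
  lookup≤norm K i = max-bound (λ j → finVal (lookup K j)) (∈-allFin i)

  replaceω : ℕ → ℕω → ℕ
  replaceω t (fin v) = v
  replaceω t ω       = t

  replaceω-≤ω : ∀ t a → fin (replaceω t a) ≤ω a
  replaceω-≤ω t (fin v) = fin≤fin ≤-refl
  replaceω-≤ω t ω       = _ ≤ω-ω

  replaceω-large : ∀ {t} a b → fin (replaceω t a) ≤ω b → finVal b < t → a ≤ω b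
  replaceω-large (fin v) b         v≤b   _   = v≤b
  replaceω-large ω       (fin w)   (fin≤fin t≤w) w<t = ⊥-elim (<⇒≱ w<t t≤w)
  replaceω-large ω       ω         _     _   = ω ≤ω-ω

  -- Ideals are prime: test J with the point that is larger than every finite bound of D wherever J is ω.
  ⊆⟦⟧⇒≤member : ∀ (D : DC d) J → (∀ x → x ∈I J → ⟦ D ⟧ x) → ∃ λ K → K ∈ D × J ≤ᵢ K
  ⊆⟦⟧⇒≤member D J J⊆D =
    let K , K∈D , x∈K = find (J⊆D x (λ i → replaceω-≤ω t (lookup J i)))
    in K , K∈D , pointwise λ i →
         replaceω-large (lookup J i) (lookup K i) (x∈K i) (s≤s (≤-trans (lookup≤norm K i) (max-bound norm K∈D)))
    where
      t : ℕ
      t = suc (foldr _⊔_ 0 (map norm D))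
      x : Point d
      x i = replaceω t (lookup J i)

  canonical-≤ᵢ⇒≡ : ∀ {D : DC d} {J K} → Canonical D → J ∈ D → K ∈ D → J ≤ᵢ K → J ≡ K
  canonical-≤ᵢ⇒≡ (_ ∷ _)  (here refl) (here refl) _   = refl
  canonical-≤ᵢ⇒≡ (J≁ ∷ _) (here refl) (there K∈D) J≤K = ⊥-elim (proj₁ (All.lookup J≁ K∈D) (≤ᵢ⇒⊆I J≤K))
  canonical-≤ᵢ⇒≡ (K≁ ∷ _) (there J∈D) (here refl) J≤K = ⊥-elim (proj₂ (All.lookup K≁ J∈D) (≤ᵢ⇒⊆I J≤K))
  canonical-≤ᵢ⇒≡ (_ ∷ c)  (there J∈D) (there K∈D) J≤K = canonical-≤ᵢ⇒≡ c J∈D K∈D J≤K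

  finite? : (J : Ideal d) → Decidable (λ i → IsFinite (lookup J i))
  finite? J i = T? (isFin (lookup J i))

  finites : Ideal d → List (Fin d)
  finites J = filter (finite? J) (allFin d)

  newlyFinite? : (J K : Ideal d) → Decidable (λ i → IsFinite (lookup J i) × T (isω (lookup K i)))
  newlyFinite? J K i = T? (isFin (lookup J i)) ×-dec T? (isω (lookup K i))

  newlyFinite : Ideal d → Ideal d → List (Fin d)
  newlyFinite J K = filter (newlyFinite? J K) (allFin d)

  length-finites+dim : ∀ (J : Ideal d) xs →
    length (filter (finite? J) xs) + sum (map (λ i → if isω (lookup J i) then 1 else 0) xs) ≡ length xs
  length-finites+dim J [] = refl
  length-finites+dim J (x ∷ xs) with lookup J x
  ... | fin _ = cong suc (length-finites+dim J xs)
  ... | ω     = trans (+-suc _ _) (cong suc (length-finites+dim J xs))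

  fdim≡length-finites : ∀ (J : Ideal d) → fdim J ≡ length (finites J)
  fdim≡length-finites J = begin
    d ∸ dim J                           ≡⟨ cong (_∸ dim J) (sym (length-tabulate (λ i → i))) ⟩
    length (allFin d) ∸ dim J           ≡⟨ cong (_∸ dim J) (sym (length-finites+dim J (allFin d))) ⟩
    length (finites J) + dim J ∸ dim J  ≡⟨ m+n∸n≡m _ (dim J) ⟩
    length (finites J)                  ∎
    where open ≡-Reasoning

  length-finites-split : ∀ {J K : Ideal d} → J ≤ᵢ K → ∀ xs →
    length (filter (finite? J) xs) ≡ length (filter (newlyFinite? J K) xs) + length (filter (finite? K) xs)
  length-finites-split J≤K [] = refl
  length-finites-split {J} {K} J≤K (x ∷ xs) with lookup J x | lookup K x | at J≤K x
  ... | fin _ | fin _ | _ = trans (cong suc (length-finites-split J≤K xs)) (sym (+-suc _ _))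
  ... | fin _ | ω     | _ = cong suc (length-finites-split J≤K xs)
  ... | ω     | ω     | _ = length-finites-split J≤K xs

  fdim-split : ∀ {J K : Ideal d} → J ≤ᵢ K → fdim J ≡ length (newlyFinite J K) + fdim K
  fdim-split {J} {K} J≤K = begin
    fdim J                                         ≡⟨ fdim≡length-finites J ⟩
    length (finites J)                             ≡⟨ length-finites-split J≤K (allFin d) ⟩
    length (newlyFinite J K) + length (finites K)  ≡⟨ cong (length (newlyFinite J K) +_) (sym (fdim≡length-finites K)) ⟩
    length (newlyFinite J K) + fdim K              ∎
    where open ≡-Reasoning

  top : Ideal d
  top = replicate d ω

  ≤ᵢ-top : ∀ {J} → J ≤ᵢ top
  ≤ᵢ-top {J} = pointwise λ i → subst (lookup J i ≤ω_) (sym (lookup-replicate i ω)) (_ ≤ω-ω)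

  fdim-top : fdim top ≡ 0
  fdim-top = trans (fdim≡length-finites top) (cong length (filter-none (finite? top) (All.tabulate top-infinite)))
    where
      top-infinite : ∀ {i} → i ∈ allFin d → ¬ IsFinite (lookup top i)
      top-infinite {i} _ rewrite lookup-replicate i ω = λ ()

module ThinEnumerations (d : ℕ) (g : ℕ → ℕ) (n₀ : ℕ) (expansive : Expansive g) where
  open Bounds d g n₀

  L-mono : ∀ {i j} → i ≤ j → L i ≤ L j
  L-mono = stepwise-monotone L (λ i → m≤m+n (L i) _)

  N-mono : ∀ {i j} → i ≤ j → N i ≤ N j
  N-mono = stepwise-monotone N N-step
    where
      N-step : ∀ i → N i ≤ N (suc i)
      N-step zero    = iter-mono expansive n₀ {0} {L 0 + 1} z≤n
      N-step (suc i) = iter-mono expansive n₀ (+-monoˡ-≤ 1 (L-mono (n≤1+n i)))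

  L-absorbs : ∀ {f m t k} → f < m → t ≤ L f → k ≤ P m → t + k ≤ L m
  L-absorbs {m = suc m} (s≤s f≤m) t≤Lf k≤P = +-mono-≤ (≤-trans t≤Lf (L-mono f≤m)) k≤P

  P≤1+L : ∀ m → P m ≤ suc (L m)
  P≤1+L zero    = ≤-refl
  P≤1+L (suc m) = ≤-trans (m≤n+m (P (suc m)) (L m)) (n≤1+n _)

  Bounded : (Fin d → ℕ) → List (Fin d) → Set
  Bounded v []       = ⊤
  Bounded v (c ∷ cs) = v c ≤ N (suc (length cs)) × Bounded v cs

  Bounded-++ : ∀ v xs {ys} → (∀ c → c ∈ xs → v c ≤ N (suc (length ys))) → Bounded v ys → Bounded v (xs ++ ys)
  Bounded-++ v []       _ bys = bys
  Bounded-++ v (x ∷ xs) {ys} bxs bys =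
    ≤-trans (bxs x (here refl)) (N-mono (s≤s (subst (length ys ≤_) (sym (length-++ xs)) (m≤n+m _ _))))
    , Bounded-++ v xs (λ c p → bxs c (there p)) bys

  Bounded-mono : ∀ {v w} xs → (∀ c → c ∈ xs → v c ≤ w c) → Bounded w xs → Bounded v xs
  Bounded-mono []       _   _          = tt
  Bounded-mono (x ∷ xs) v≤w (bx , bxs) = ≤-trans (v≤w x (here refl)) bx , Bounded-mono xs (λ c p → v≤w c (there p)) bxs

  Bounded-lookup : ∀ {v c} xs → Bounded v xs → (p : c ∈ xs) → v c ≤ N (suc (toℕ (opposite (Any.index p))))
  Bounded-lookup {v} (x ∷ xs) (bx , _) (here refl) =
    subst (λ k → v x ≤ N (suc k)) (sym (Finₚ.toℕ-fromℕ (length xs))) bx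
  Bounded-lookup {v} {c} (x ∷ xs) (_ , bxs) (there p) =
    subst (λ k → v c ≤ N (suc k)) (sym (Finₚ.opposite-suc (Any.index p))) (Bounded-lookup xs bxs p)

  -- The paper's σ sends the head of `coords` to fdim J and the last entry to 1.
  record ThinEnum (J : Ideal d) : Set where
    field
      coords      : List (Fin d)
      unique      : Unique coords
      length≡fdim : length coords ≡ fdim J
      finite⇒∈    : ∀ i → IsFinite (lookup J i) → i ∈ coords
      ∈⇒finite    : ∀ {i} → i ∈ coords → IsFinite (lookup J i)
      bounded     : Bounded (λ i → finVal (lookup J i)) coords

  thinEnum⇒thin : ∀ {J} → ThinEnum J → Thin J
  thinEnum⇒thin {J} t = enumeration⇒thin coords unique finite⇒∈ ∈⇒finite bounded length≡fdim
    where
      open ThinEnum t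

      FinCoord-≡ : ∀ {i j} → i ≡ j → (a : IsFinite (lookup J i)) (b : IsFinite (lookup J j)) →
                   _≡_ {A = FinCoord J} (i , a) (j , b)
      FinCoord-≡ refl a b = cong (_ ,_) (T-irrelevant a b)

      enumeration⇒thin : ∀ xs → Unique xs → (∀ i → IsFinite (lookup J i) → i ∈ xs) →
        (∀ {i} → i ∈ xs → IsFinite (lookup J i)) → Bounded (λ i → finVal (lookup J i)) xs →
        ∀ {m} → length xs ≡ m →
        Σ (FinCoord J ⤖ Fin m) λ σ → ∀ c → finVal (lookup J (proj₁ c)) ≤ N (suc (toℕ (Bijection.to σ c)))
      enumeration⇒thin xs u fin⇒∈ ∈⇒fin bxs refl =
        ↔⇒⤖ (mk↔ₛ′ to from to∘from from∘to) , λ (i , t) → Bounded-lookup xs bxs (fin⇒∈ i t)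
        where
          to : FinCoord J → Fin (length xs)
          to (i , t) = opposite (Any.index (fin⇒∈ i t))
          from : Fin (length xs) → FinCoord J
          from r = List.lookup xs (opposite r) , ∈⇒fin (∈-lookup {xs = xs} (opposite r))
          to∘from : ∀ r → to (from r) ≡ r
          to∘from r = begin
            opposite (Any.index (fin⇒∈ _ _))
              ≡⟨ cong (λ p → opposite (Any.index p)) (unique⇒irrelevant u _ _) ⟩
            opposite (Any.index (∈-lookup {xs = xs} (opposite r)))
              ≡⟨ cong opposite (index-∈-lookup xs (opposite r)) ⟩
            opposite (opposite r)
              ≡⟨ Finₚ.opposite-involutive {length xs} r ⟩
            r ∎
            where open ≡-Reasoning
          from∘to : ∀ c → from (to c) ≡ c
          from∘to (i , t) = FinCoord-≡
            (trans (cong (List.lookup xs) (Finₚ.opposite-involutive {length xs} _)) (sym (lookup-index (fin⇒∈ i t)))) _ t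

  topEnum : ThinEnum top
  topEnum = record
    { coords      = []
    ; unique      = []
    ; length≡fdim = sym (fdim-top {d})
    ; finite⇒∈    = λ i t → ⊥-elim (subst IsFinite (lookup-replicate i ω) t)
    ; ∈⇒finite    = λ ()
    ; bounded     = tt
    }

  extend : ∀ {J K} → J ≤ᵢ K → ThinEnum K → (∀ i → finVal (lookup J i) ≤ N (suc (fdim K))) → ThinEnum J
  extend {J} {K} J≤K tK bound = record
    { coords      = new ++ coords
    ; unique      = Uniqueₚ.++⁺ (Uniqueₚ.filter⁺ (newlyFinite? J K) (Uniqueₚ.allFin⁺ d)) unique
                      λ (p , q) → finite∧ω⇒⊥ _ (∈⇒finite q)
                                    (proj₂ (proj₂ (∈-filter⁻ (newlyFinite? J K) {xs = allFin d} p)))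
    ; length≡fdim = trans (length-++ new) (trans (cong (length new +_) length≡fdim) (sym (fdim-split J≤K)))
    ; finite⇒∈    = λ i t → [ (λ f → ++⁺ʳ new {ys = coords} (finite⇒∈ i f))
                            , (λ w → ++⁺ˡ (∈-filter⁺ (newlyFinite? J K) (∈-allFin i) (t , w))) ]′ (finite⊎ω (lookup K i))
    ; ∈⇒finite    = [ (λ p → proj₁ (proj₂ (∈-filter⁻ (newlyFinite? J K) {xs = allFin d} p)))
                    , (λ p → ≤ω-finite (at J≤K _) (∈⇒finite p)) ]′ ∘ ++⁻ new
    ; bounded     = Bounded-++ _ new (λ c _ → subst (λ k → finVal (lookup J c) ≤ N (suc k)) (sym length≡fdim) (bound c))
                      (Bounded-mono coords (λ c p → ≤ω-finVal (at J≤K c) (∈⇒finite p)) bounded)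
    }
    where
      open ThinEnum tK
      new : List (Fin d)
      new = newlyFinite J K

  unchosen : List (Fin d) → List (Fin d)
  unchosen []       = allFin d
  unchosen (c ∷ cs) = remove _≟ᶠ_ c (unchosen cs)

  ∉⇒∈-unchosen : ∀ {y} cs → y ∉ cs → y ∈ unchosen cs
  ∉⇒∈-unchosen {y} []       _   = ∈-allFin y
  ∉⇒∈-unchosen     (c ∷ cs) y∉ = ∈-remove _≟ᶠ_ (unchosen cs) (∉⇒∈-unchosen cs (y∉ ∘ there)) (y∉ ∘ here)

  length-unchosen : ∀ {cs} → Unique cs → length (unchosen cs) ≡ d ∸ length cs
  length-unchosen {[]}     _         = length-tabulate (λ i → i)
  length-unchosen {c ∷ cs} (c∉ ∷ u) = begin
    length (remove _≟ᶠ_ c (unchosen cs))        ≡⟨ cong pred (length-remove _≟ᶠ_ (unchosen cs) (∉⇒∈-unchosen cs c∉cs)) ⟩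
    pred (length (unchosen cs))                 ≡⟨ cong pred (length-unchosen u) ⟩
    pred (d ∸ length cs)                        ≡⟨ pred[m∸n]≡m∸[1+n] d (length cs) ⟩
    d ∸ suc (length cs)                         ∎
    where
      open ≡-Reasoning
      c∉cs : c ∉ cs
      c∉cs = All¬⇒¬Any c∉

  -- A mixed-radix code: the coordinate carrying index m contributes its position among the d - m + 1
  -- coordinates not yet used by the rest of the list, and its value, which is at most N m.
  code : (v : Fin d → ℕ) (m : ℕ) (cs : List (Fin d)) → length cs ≡ m → Fin (P m)
  code v zero    []       _  = Fin.zero
  code v (suc m) (c ∷ cs) eq =
    combine (code v m cs (suc-injective eq))
            (combine (clamp (d ∸ suc m) (position _≟ᶠ_ c (unchosen cs))) (clamp (N (suc m)) (v c)))

  position-unchosen≤ : ∀ {c cs m} → Unique cs → c ∉ cs → length cs ≡ m → position _≟ᶠ_ c (unchosen cs) ≤ d ∸ suc m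
  position-unchosen≤ {c} {cs} {m} u c∉cs refl = begin
    position _≟ᶠ_ c (unchosen cs)         ≤⟨ pred-mono-≤ (position< _≟ᶠ_ (unchosen cs) (∉⇒∈-unchosen cs c∉cs)) ⟩
    pred (length (unchosen cs))           ≡⟨ cong pred (length-unchosen u) ⟩
    pred (d ∸ length cs)                  ≡⟨ pred[m∸n]≡m∸[1+n] d (length cs) ⟩
    d ∸ suc (length cs)                   ∎
    where open ≤-Reasoning

  code-injective : ∀ {v w} m cs ds (ecs : length cs ≡ m) (eds : length ds ≡ m) → Unique cs → Unique ds →
    Bounded v cs → Bounded w ds → code v m cs ecs ≡ code w m ds eds → cs ≡ ds × (∀ c → c ∈ cs → v c ≡ w c)
  code-injective zero [] [] _ _ _ _ _ _ _ = refl , λ _ ()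
  code-injective {v} {w} (suc m) (c ∷ cs) (c′ ∷ ds) ecs eds (c∉ ∷ ucs) (c′∉ ∷ uds) (bc , bcs) (bc′ , bds) eq
    with Finₚ.combine-injective _ _ _ _ eq
  ... | eq-tail , eq-digit
    with Finₚ.combine-injective _ _ _ _ eq-digit | code-injective m cs ds _ _ ucs uds bcs bds eq-tail
  ... | eq-position , eq-value | refl , agree-tail
    with position-injective _≟ᶠ_ (unchosen cs) (∉⇒∈-unchosen cs (All¬⇒¬Any c∉)) (∉⇒∈-unchosen cs (All¬⇒¬Any c′∉))
           (clamp-injective (position-unchosen≤ ucs (All¬⇒¬Any c∉) (suc-injective ecs))
                            (position-unchosen≤ ucs (All¬⇒¬Any c′∉) (suc-injective eds)) eq-position)
  ... | refl = refl , λ where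
    _ (here refl) → clamp-injective (subst (λ k → v c ≤ N k) ecs bc) (subst (λ k → w c ≤ N k) eds bc′) eq-value
    x (there x∈)  → agree-tail x x∈

  ThinEnum-≡ : ∀ {J K} (tJ : ThinEnum J) (tK : ThinEnum K) → ThinEnum.coords tJ ≡ ThinEnum.coords tK →
               (∀ i → i ∈ ThinEnum.coords tJ → finVal (lookup J i) ≡ finVal (lookup K i)) → J ≡ K
  ThinEnum-≡ {J} {K} tJ tK same-coords agree = Ideal-ext entry
    where
      open ThinEnum
      entry : ∀ i → lookup J i ≡ lookup K i
      entry i with finite⊎ω (lookup J i) | finite⊎ω (lookup K i)
      ... | inj₁ fJ | inj₁ fK =
        trans (finite⇒≡fin fJ) (trans (cong fin (agree i (finite⇒∈ tJ i fJ))) (sym (finite⇒≡fin fK)))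
      ... | inj₁ fJ | inj₂ ωK = ⊥-elim (finite∧ω⇒⊥ _ (∈⇒finite tK (subst (i ∈_) same-coords (finite⇒∈ tJ i fJ))) ωK)
      ... | inj₂ ωJ | inj₁ fK = ⊥-elim (finite∧ω⇒⊥ _ (∈⇒finite tJ (subst (i ∈_) (sym same-coords) (finite⇒∈ tK i fK))) ωJ)
      ... | inj₂ ωJ | inj₂ ωK = trans (ω⇒≡ω ωJ) (sym (ω⇒≡ω ωK))

  thinCode : ∀ {J m} → ThinEnum J → fdim J ≡ m → Fin (P m)
  thinCode {J} t eq = code (λ i → finVal (lookup J i)) _ coords (trans length≡fdim eq)
    where open ThinEnum t

  thinCode-injective : ∀ {J K m} (tJ : ThinEnum J) (tK : ThinEnum K) (eJ : fdim J ≡ m) (eK : fdim K ≡ m) →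
                       thinCode tJ eJ ≡ thinCode tK eK → J ≡ K
  thinCode-injective {m = m} tJ tK eJ eK same-code = uncurry (ThinEnum-≡ tJ tK)
    (code-injective m (coords tJ) (coords tK) (trans (length≡fdim tJ) eJ) (trans (length≡fdim tK) eK)
                    (unique tJ) (unique tK) (bounded tJ) (bounded tK) same-code)
    where open ThinEnum

module ChainAnalysis {d : ℕ} (g : ℕ → ℕ) (expansive : Expansive g) (n₀ n : ℕ) (D : ℕ → DC d)
  (descending : Chain.IsDescendingChain D n) (strongly-monotone : Chain.StronglyMonotone D n)
  (controlled : Chain.Controlled D g n₀ n) where

  open Chain D
  open Bounds d g n₀
  open ThinEnumerations d g n₀ expansive
  open DecMembership (Vecₚ.≡-dec {n = d} _≟ω_) using (_∈?_)

  canonical : ∀ {k} → k ≤ n → Canonical (D k)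
  canonical {k} = proj₁ descending k

  ⟦⟧-antitone : ∀ {t s} → t ≤ s → s ≤ n → ⟦ D s ⟧ ⊆S ⟦ D t ⟧
  ⟦⟧-antitone t≤s = go (≤⇒≤′ t≤s)
    where
      go : ∀ {t s} → t ≤′ s → s ≤ n → ⟦ D s ⟧ ⊆S ⟦ D t ⟧
      go ≤′-refl       _   x x∈ = x∈
      go (≤′-step t≤s) s≤n x x∈ = go t≤s (<⇒≤ s≤n) x (proj₁ (proj₂ descending _ s≤n) x x∈)

  ≤ᵢ-earlier-member : ∀ {t s J} → t ≤ s → s ≤ n → J ∈ D s → ∃ λ K → K ∈ D t × J ≤ᵢ K
  ≤ᵢ-earlier-member {t} {J = J} t≤s s≤n J∈ =
    ⊆⟦⟧⇒≤member (D t) J λ x x∈J → ⟦⟧-antitone t≤s s≤n x (lose J∈ x∈J)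

  -- Through I ≤ K ≤ K′ with K ∈ D (t + 1) and K′ ∈ D t, canonicity at t forces I = K′ and then I = K.
  proper-never-returns : ∀ {t s I} → t < s → s ≤ n → Proper t I → ¬ I ∈ D s
  proper-never-returns {t} t<s s≤n (I∈ , I∉) I∈s
    with ≤ᵢ-earlier-member t<s s≤n I∈s
  ... | K , K∈ , I≤K with ≤ᵢ-earlier-member (n≤1+n t) (≤-trans t<s s≤n) K∈
  ... | K′ , K′∈ , K≤K′ with canonical-≤ᵢ⇒≡ (canonical (<⇒≤ (<-≤-trans t<s s≤n))) I∈ K′∈ (≤ᵢ-trans I≤K K≤K′)
  ... | refl = I∉ (subst (_∈ D (suc t)) (sym (≤ᵢ-antisym I≤K K≤K′)) K∈)

  ThinAt : ℕ → Set
  ThinAt k = k ≤ n → ∀ J → J ∈ D k → ThinEnum J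

  EarlyAt : ℕ → Set
  EarlyAt k = k < n → ∀ I → Proper k I → k ≤ L (fdim I)

  member-entry≤iter : ∀ {k J} → k ≤ n → J ∈ D k → ∀ i → finVal (lookup J i) ≤ iter g k n₀
  member-entry≤iter {k} {J} k≤n J∈ i = ≤-trans (lookup≤norm J i) (controlled k k≤n J J∈)

  thin-at-0 : ThinAt 0
  thin-at-0 0≤n J J∈ = extend (≤ᵢ-top {d}) topEnum λ i →
    subst (λ f → finVal (lookup J i) ≤ N (suc f)) (sym (fdim-top {d}))
          (≤-trans (member-entry≤iter 0≤n J∈ i) (N-mono {0} {1} z≤n))

  thin-at-suc : ∀ {k} → ThinAt k → EarlyAt k → ThinAt (suc k)
  thin-at-suc {k} thin early k<n J J∈ with ≤ᵢ-earlier-member (n≤1+n k) k<n J∈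
  ... | K , K∈ , J≤K with K ∈? D (suc k)
  ...   | yes K∈′ = subst ThinEnum (sym (canonical-≤ᵢ⇒≡ (canonical k<n) J∈ K∈′ J≤K)) (thin (<⇒≤ k<n) K K∈)
  ...   | no  K∉  = extend J≤K (thin (<⇒≤ k<n) K K∈) λ i →
    ≤-trans (member-entry≤iter k<n J∈ i)
            (iter-mono expansive n₀ (≤-trans (≤-reflexive (+-comm 1 k)) (+-monoˡ-≤ 1 (early k<n K (K∈ , K∉)))))

  module EarlyBound (ℓ : ℕ) (thin : ∀ {k} → k ≤ ℓ → ThinAt k) (earlier : ∀ {t} → t < ℓ → EarlyAt t)
                    (ℓ<n : ℓ < n) (I : Ideal d) (proper : Proper ℓ I) where

    trace : ∀ c {t} → t + c ≡ ℓ → ∃ λ J → Proper t J × fdim J ≤ fdim I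
    trace zero {t} t+0≡ℓ =
      I , subst (λ s → Proper s I) (sym (trans (sym (+-identityʳ t)) t+0≡ℓ)) proper , ≤-refl
    trace (suc c) {t} t+1+c≡ℓ with trace c {suc t} (trans (sym (+-suc t c)) t+1+c≡ℓ)
    ... | J , J-proper , J≤I
      with strongly-monotone t (≤-<-trans (subst (t <_) t+1+c≡ℓ (m<m+n t z<s)) ℓ<n) J J-proper
    ... | J′ , J′-proper , dimJ≤dimJ′ = J′ , J′-proper , ≤-trans (∸-monoʳ-≤ d dimJ≤dimJ′) J≤I

    ancestor : ∀ c → c ≤ ℓ → Ideal d
    ancestor c c≤ℓ = proj₁ (trace c (m∸n+n≡m c≤ℓ))

    ancestor-proper : ∀ c (c≤ℓ : c ≤ ℓ) → Proper (ℓ ∸ c) (ancestor c c≤ℓ)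
    ancestor-proper c c≤ℓ = proj₁ (proj₂ (trace c (m∸n+n≡m c≤ℓ)))

    ancestor-thin : ∀ c (c≤ℓ : c ≤ ℓ) → ThinEnum (ancestor c c≤ℓ)
    ancestor-thin c c≤ℓ = thin (m∸n≤m ℓ c) (≤-trans (m∸n≤m ℓ c) (<⇒≤ ℓ<n)) _ (proj₁ (ancestor-proper c c≤ℓ))

    ancestors-distinct : ∀ {c c′} (c≤ℓ : c ≤ ℓ) (c′≤ℓ : c′ ≤ ℓ) → c < c′ → ancestor c c≤ℓ ≢ ancestor c′ c′≤ℓ
    ancestors-distinct {c} {c′} c≤ℓ c′≤ℓ c<c′ same =
      proper-never-returns (∸-monoʳ-< c<c′ c′≤ℓ) (≤-trans (m∸n≤m ℓ c) (<⇒≤ ℓ<n)) (ancestor-proper c′ c′≤ℓ)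
        (subst (_∈ D (ℓ ∸ c)) same (proj₁ (ancestor-proper c c≤ℓ)))

    Plateau : ℕ → Set
    Plateau k = ∀ c (c≤ℓ : c ≤ ℓ) → c < k → fdim (ancestor c c≤ℓ) ≡ fdim I

    plateau-length : ∀ k → k ≤ suc ℓ → Plateau k → k ≤ P (fdim I)
    plateau-length k k≤1+ℓ plateau = ≮⇒≥ λ P<k →
      let i , j , i<j , same-code = Finₚ.pigeonhole P<k plateau-code
      in ancestors-distinct (index≤ℓ i) (index≤ℓ j) i<j
           (thinCode-injective (thin-at i) (thin-at j) (plateau-at i) (plateau-at j) same-code)
      where
        index≤ℓ : (i : Fin k) → toℕ i ≤ ℓ
        index≤ℓ i = s≤s⁻¹ (≤-trans (Finₚ.toℕ<n i) k≤1+ℓ)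
        thin-at : (i : Fin k) → ThinEnum (ancestor (toℕ i) (index≤ℓ i))
        thin-at i = ancestor-thin (toℕ i) (index≤ℓ i)
        plateau-at : (i : Fin k) → fdim (ancestor (toℕ i) (index≤ℓ i)) ≡ fdim I
        plateau-at i = plateau (toℕ i) (index≤ℓ i) (Finₚ.toℕ<n i)
        plateau-code : Fin k → Fin (P (fdim I))
        plateau-code i = thinCode (thin-at i) (plateau-at i)

    drop-bound : ∀ k (k≤ℓ : k ≤ ℓ) → fdim (ancestor k k≤ℓ) < fdim I → k ≤ P (fdim I) → ℓ ≤ L (fdim I)
    drop-bound zero    _   drop _   = ⊥-elim (<-irrefl refl drop)
    drop-bound (suc k) k≤ℓ drop k≤P = subst (_≤ L (fdim I)) (m∸n+n≡m k≤ℓ)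
      (L-absorbs drop (earlier t<ℓ (<-trans t<ℓ ℓ<n) _ (ancestor-proper (suc k) k≤ℓ)) k≤P)
      where
        t<ℓ : ℓ ∸ suc k < ℓ
        t<ℓ = ∸-monoʳ-< z<s k≤ℓ

    bound-from-plateau : ∀ r k → r + k ≡ suc ℓ → Plateau k → ℓ ≤ L (fdim I)
    bound-from-plateau zero    k refl plateau = s≤s⁻¹ (≤-trans (plateau-length (suc ℓ) ≤-refl plateau) (P≤1+L (fdim I)))
    bound-from-plateau (suc r) k r+k≡ℓ plateau = continue (subst (k ≤_) (suc-injective r+k≡ℓ) (m≤n+m k r))
      where
        continue : k ≤ ℓ → ℓ ≤ L (fdim I)
        continue k≤ℓ with fdim (ancestor k k≤ℓ) <? fdim I
        ... | yes drop = drop-bound k k≤ℓ drop (plateau-length k (≤-trans k≤ℓ (n≤1+n ℓ)) plateau)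
        ... | no  same = bound-from-plateau r (suc k) (trans (+-suc r k) r+k≡ℓ) longer-plateau
          where
            longer-plateau : Plateau (suc k)
            longer-plateau c c≤ℓ c<1+k with m≤n⇒m<n∨m≡n (s≤s⁻¹ c<1+k)
            ... | inj₁ c<k  = plateau c c≤ℓ c<k
            ... | inj₂ refl rewrite ≤-irrelevant c≤ℓ k≤ℓ = ≤-antisym (proj₂ (proj₂ (trace c _))) (≮⇒≥ same)

    result : ℓ ≤ L (fdim I)
    result = bound-from-plateau (suc ℓ) 0 (+-identityʳ (suc ℓ)) λ _ _ ()

  thin-from-earlier : ∀ ℓ → (∀ {t} → t < ℓ → ThinAt t × EarlyAt t) → ThinAt ℓ
  thin-from-earlier zero    _   = thin-at-0
  thin-from-earlier (suc k) rec = thin-at-suc (proj₁ (rec ≤-refl)) (proj₂ (rec ≤-refl))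

  thin-and-early : ∀ ℓ → ThinAt ℓ × EarlyAt ℓ
  thin-and-early = <-rec _ λ ℓ rec → thin-upto ℓ rec ≤-refl , λ ℓ<n I proper →
    EarlyBound.result ℓ (thin-upto ℓ rec) (λ t<ℓ → proj₂ (rec t<ℓ)) ℓ<n I proper
    where
      thin-upto : ∀ ℓ → (∀ {t} → t < ℓ → ThinAt t × EarlyAt t) → ∀ {k} → k ≤ ℓ → ThinAt k
      thin-upto ℓ rec k≤ℓ with m≤n⇒m<n∨m≡n k≤ℓ
      ... | inj₁ k<ℓ  = proj₁ (rec k<ℓ)
      ... | inj₂ refl = thin-from-earlier ℓ rec

lemma3p4 : (d : ℕ) → 1 ≤ d → (g : ℕ → ℕ) → Monotone g → Expansive g → (n₀ : ℕ)
    → (n : ℕ) → (D : ℕ → DC d)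
    → Chain.IsDescendingChain D n → Chain.StronglyMonotone D n → Chain.Controlled D g n₀ n
    → ∀ ℓ → ℓ < n → ∀ (I : Ideal d) → Chain.Proper D ℓ I
    → Bounds.Thin d g n₀ I × ℓ ≤ Bounds.L d g n₀ (fdim I)
lemma3p4 d _ g _ expansive n₀ n D descending strongly-monotone controlled ℓ ℓ<n I proper =
  thinEnum⇒thin (proj₁ (thin-and-early ℓ) (<⇒≤ ℓ<n) I (proj₁ proper)) , proj₂ (thin-and-early ℓ) ℓ<n I proper
  where
    open ChainAnalysis g expansive n₀ n D descending strongly-monotone controlled
    open ThinEnumerations d g n₀ expansive using (thinEnum⇒thin)
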